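{- For each integer $n \ge 1$, let $C_n$ be the chain $a_0 < a_1 < \cdots < a_{n-1}$ with $\wedge = \min$, $\vee = \max$, $0 = a_0$, $1 = a_{n-1}$, and let $N(n)$ be the number of binary operations $\to$ on $C_n$ such that $\langle C_n, \vee, \wedge, \to, 0, 1\rangle$ is a semi-Heyting algebra. Then for every $n \ge 2$, $N(n)$ is even.
   Context: An algebra $\langle L, \vee, \wedge, \to, 0, 1\rangle$ is a semi-Heyting algebra if: (SH1) $\langle L, \vee, \wedge, 0, 1\rangle$ is a lattice with least element $0$ and greatest element $1$; (SH2) $x \wedge (x \to y) = x \wedge y$ for all $x,y$; (SH3) $x \wedge (y \to z) = x \wedge [(x \wedge y) \to (x \wedge z)]$ for all $x,y,z$; (SH4) $x \to x = 1$ for all $x$. -}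

module Defs where

open import Data.Nat using (ℕ; zero; suc)
open import Data.Fin using (Fin; zero; suc; fromℕ; _≤?_; _≟_)
open import Data.Fin.Properties using (all?)
open import Data.List using (List; []; _∷_; map; concatMap; filter; length; [_])
open import Data.Product using (_×_)
open import Relation.Nullary using (Dec; yes; no)
open import Relation.Nullary.Decidable using (_×-dec_)
open import Relation.Binary.PropositionalEquality using (_≡_)

-- The chain C_n is modelled by Fin n with its natural order
-- (a_i is represented by the element i of Fin n).

_∧_ : ∀ {n} → Fin n → Fin n → Fin n
x ∧ y with x ≤? y
... | yes _ = x
... | no  _ = y

_∨_ : ∀ {n} → Fin n → Fin n → Fin n
x ∨ y with x ≤? y
... | yes _ = y
... | no  _ = x

bot : ∀ m → Fin (suc m)
bot m = zero

top : ∀ m → Fin (suc m)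
top m = fromℕ m

Op : ℕ → Set
Op n = Fin n → Fin n → Fin n

-- (SH1) holds automatically: (C_n, ∨, ∧, 0, 1) is a bounded lattice.
-- Axioms (SH2)-(SH4) for an operation ⇒ on C_(m+1).
IsSemiHeyting : ∀ m → Op (suc m) → Set
IsSemiHeyting m _⇒_ =
  (∀ x y → x ∧ (x ⇒ y) ≡ x ∧ y) ×
  (∀ x y z → x ∧ (y ⇒ z) ≡ x ∧ ((x ∧ y) ⇒ (x ∧ z))) ×
  (∀ x → x ⇒ x ≡ top m)

isSemiHeyting? : ∀ m (f : Op (suc m)) → Dec (IsSemiHeyting m f)
isSemiHeyting? m f =
  all? (λ x → all? (λ y → (x ∧ f x y) ≟ (x ∧ y))) ×-dec
  (all? (λ x → all? (λ y → all? (λ z →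
      (x ∧ f y z) ≟ (x ∧ f (x ∧ y) (x ∧ z))))) ×-dec
   all? (λ x → f x x ≟ top m))

funs : ∀ {A : Set} (k : ℕ) → List A → List (Fin k → A)
funs zero    xs = [ (λ ()) ]
funs (suc k) xs =
  concatMap (λ a → map (λ f → λ { zero → a ; (suc i) → f i }) (funs k xs)) xs

allFinL : ∀ n → List (Fin n)
allFinL zero    = []
allFinL (suc n) = zero ∷ map suc (allFinL n)

-- Every binary operation on C_n, each occurring exactly once.
allOps : ∀ n → List (Op n)
allOps n = funs n (funs n (allFinL n))

-- N(n): number of operations → making C_n a semi-Heyting algebra.
-- (C_0 does not exist; we set N 0 = 0, which is never used.)
N : ℕ → ℕ
N zero    = 0
N (suc m) = length (filter (isSemiHeyting? m) (allOps (suc m)))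

module Submission where

-- Let n = p + 2, let r = a_p be the second largest element of the chain C_n
-- and c = a_(p+1) its top.  For a semi-Heyting operation f, axiom (SH2) at
-- (r, c) says r ∧ f r c = r, i.e. f r c ∈ {r, c}.  Conversely, if g agrees
-- with a semi-Heyting f everywhere except at (r, c) and r ≤ g r c, then g is
-- semi-Heyting again: (SH4) never evaluates at (r, c), and every instance of
-- (SH2), (SH3) that does is satisfied as soon as r ≤ g r c.  Hence the map σ
-- exchanging r and c in the entry at (r, c) is an involution of the
-- semi-Heyting operations that exchanges those with f r c = r and those with
-- f r c = c, so N(n) is twice the number of the latter.

open import Defs
open import Data.Nat using (ℕ; zero; suc; _+_; _*_; _≤_; z≤n; s≤s)
open import Data.Nat.Divisibility using (_∣_; divides)
open import Data.Nat.Properties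
  using (+-identityʳ; *-comm; ≰⇒≥; +-commutativeSemigroup)
open import Data.Nat.ListAction using (sum)
open import Data.Nat.ListAction.Properties using (sum-++)
open import Data.Fin using (Fin; zero; suc; _≟_; _≤?_)
  renaming (_≤_ to _≤ᶠ_)
open import Data.Fin.Properties
  using (≤fromℕ; ≤-antisym; ≤-trans; ≤-refl; suc-injective)
open import Data.List using (List; []; _∷_; _++_; map; concatMap; filter; length)
open import Data.List.Properties using (map-cong; map-∘; map-++)
open import Data.Product using (_×_; _,_; proj₁; proj₂)
open import Data.Sum using (_⊎_; inj₁; inj₂; [_,_]′)
open import Data.Empty using (⊥-elim)
open import Data.Bool using (true; false; if_then_else_)
open import Function using (_∘_)
open import Relation.Nullary using (Dec; yes; no; ¬_; does)
open import Relation.Nullary.Decidable using (_×-dec_)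
open import Relation.Binary.PropositionalEquality
  using (_≡_; refl; sym; trans; cong; cong₂; subst; module ≡-Reasoning)
open import Algebra.Properties.CommutativeSemigroup +-commutativeSemigroup
  using (interchange; x∙yz≈y∙xz)

open ≡-Reasoning

𝟙 : ∀ {A : Set} → Dec A → ℕ
𝟙 d = if does d then 1 else 0

𝟙-cong : ∀ {A B : Set} (a : Dec A) (b : Dec B) → (A → B) → (B → A) → 𝟙 a ≡ 𝟙 b
𝟙-cong (yes _) (yes _) _   _   = refl
𝟙-cong (no  _) (no  _) _   _   = refl
𝟙-cong (yes a) (no ¬b) a→b _   = ⊥-elim (¬b (a→b a))
𝟙-cong (no ¬a) (yes b) _   b→a = ⊥-elim (¬a (b→a b))

𝟙-split : ∀ {A B C : Set} (a : Dec A) (b : Dec B) (c : Dec C) →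
  (A → B ⊎ C) → ¬ (B × C) → 𝟙 a ≡ 𝟙 (a ×-dec b) + 𝟙 (a ×-dec c)
𝟙-split (no _)  _       _       _     _    = refl
𝟙-split (yes _) (yes _) (no _)  _     _    = refl
𝟙-split (yes _) (no _)  (yes _) _     _    = refl
𝟙-split (yes _) (yes b) (yes c) _     excl = ⊥-elim (excl (b , c))
𝟙-split (yes a) (no ¬b) (no ¬c) cover _    = ⊥-elim ([ ¬b , ¬c ]′ (cover a))

length-filter : ∀ {A : Set} {P : A → Set} (P? : ∀ x → Dec (P x)) (xs : List A) →
  length (filter P? xs) ≡ sum (map (𝟙 ∘ P?) xs)
length-filter P? [] = refl
length-filter P? (x ∷ xs) with does (P? x)
... | true  = cong suc (length-filter P? xs)
... | false = length-filter P? xs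

sum-map-cong : ∀ {A : Set} {f g : A → ℕ} → (∀ a → f a ≡ g a) →
  ∀ xs → sum (map f xs) ≡ sum (map g xs)
sum-map-cong f≗g xs = cong sum (map-cong f≗g xs)

sum-map-+ : ∀ {A : Set} (f g : A → ℕ) (xs : List A) →
  sum (map (λ a → f a + g a) xs) ≡ sum (map f xs) + sum (map g xs)
sum-map-+ f g [] = refl
sum-map-+ f g (x ∷ xs) = begin
  (f x + g x) + sum (map (λ a → f a + g a) xs)
    ≡⟨ cong ((f x + g x) +_) (sum-map-+ f g xs) ⟩
  (f x + g x) + (sum (map f xs) + sum (map g xs))
    ≡⟨ interchange (f x) (g x) _ _ ⟩
  (f x + sum (map f xs)) + (g x + sum (map g xs)) ∎

sum-concatMap : ∀ {A B : Set} (w : B → ℕ) (g : A → List B) (ys : List A) →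
  sum (map w (concatMap g ys)) ≡ sum (map (λ a → sum (map w (g a))) ys)
sum-concatMap w g [] = refl
sum-concatMap w g (y ∷ ys) = begin
  sum (map w (g y ++ concatMap g ys))
    ≡⟨ cong sum (map-++ w (g y) (concatMap g ys)) ⟩
  sum (map w (g y) ++ map w (concatMap g ys))
    ≡⟨ sum-++ (map w (g y)) _ ⟩
  sum (map w (g y)) + sum (map w (concatMap g ys))
    ≡⟨ cong (sum (map w (g y)) +_) (sum-concatMap w g ys) ⟩
  sum (map w (g y)) + sum (map (λ a → sum (map w (g a))) ys) ∎


Invariant : ∀ {B : Set} → (B → B → Set) → (B → ℕ) → Set
Invariant _≈_ w = ∀ x y → x ≈ y → w x ≡ w y

IsSymmetry : ∀ {B : Set} → (B → B → Set) → List B → (B → B) → Set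
IsSymmetry _≈_ ys φ =
  ∀ w → Invariant _≈_ w → sum (map w ys) ≡ sum (map (w ∘ φ) ys)

cons : ∀ {A : Set} {k} → A → (Fin k → A) → Fin (suc k) → A
cons a f zero    = a
cons a f (suc i) = f i

upd : ∀ {A : Set} {k} → Fin k → (A → A) → (Fin k → A) → Fin k → A
upd zero    φ f zero    = φ (f zero)
upd zero    φ f (suc l) = f (suc l)
upd (suc j) φ f zero    = f zero
upd (suc j) φ f (suc l) = upd j φ (f ∘ suc) l

upd-here : ∀ {A : Set} {k} (i : Fin k) (φ : A → A) f → upd i φ f i ≡ φ (f i)
upd-here zero    φ f = refl
upd-here (suc i) φ f = upd-here i φ (f ∘ suc)

upd-elsewhere : ∀ {A : Set} {k} (i j : Fin k) (φ : A → A) f →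
  ¬ j ≡ i → upd i φ f j ≡ f j
upd-elsewhere zero    zero    φ f j≢i = ⊥-elim (j≢i refl)
upd-elsewhere zero    (suc j) φ f j≢i = refl
upd-elsewhere (suc i) zero    φ f j≢i = refl
upd-elsewhere (suc i) (suc j) φ f j≢i =
  upd-elsewhere i j φ (f ∘ suc) (j≢i ∘ cong suc)

-- Throughout, A carries a reflexive relation ~ (equality, or pointwise
-- equality when A is itself a function space), lifted pointwise to ≋.
module Reindexing {A : Set} (_~_ : A → A → Set) (~-refl : ∀ {a} → a ~ a) where

  _≋_ : ∀ {k} → (Fin k → A) → (Fin k → A) → Set
  f ≋ g = ∀ i → f i ~ g i

  Congruent : (A → A) → Set
  Congruent φ = ∀ a b → a ~ b → φ a ~ φ b

  cons-≋ : ∀ {k a b} {f g : Fin k → A} → a ~ b → f ≋ g → cons a f ≋ cons b g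
  cons-≋ a~b f≋g zero    = a~b
  cons-≋ a~b f≋g (suc i) = f≋g i

  upd-≋ : ∀ {k} (i : Fin k) {φ} → Congruent φ →
    ∀ {f g} → f ≋ g → upd i φ f ≋ upd i φ g
  upd-≋ zero    φ-cong f≋g zero    = φ-cong _ _ (f≋g zero)
  upd-≋ zero    φ-cong f≋g (suc l) = f≋g (suc l)
  upd-≋ (suc j) φ-cong f≋g zero    = f≋g zero
  upd-≋ (suc j) φ-cong f≋g (suc l) = upd-≋ j φ-cong (f≋g ∘ suc) l

  headSum : ∀ {k} → List A → ((Fin (suc k) → A) → ℕ) → A → ℕ
  headSum {k} ys w a = sum (map (w ∘ cons a) (funs k ys))

  sum-funs-suc : ∀ {k} ys (w : (Fin (suc k) → A) → ℕ) → Invariant _≋_ w →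
    sum (map w (funs (suc k) ys)) ≡ sum (map (headSum ys w) ys)
  sum-funs-suc {k} ys w w-inv =
    trans (sum-concatMap w _ ys) (sum-map-cong regroup ys)
    where
    regroup : ∀ a → sum (map w (map _ (funs k ys))) ≡ headSum ys w a
    regroup a = trans (cong sum (sym (map-∘ (funs k ys))))
      (sum-map-cong (λ f → w-inv _ _ (λ { zero → ~-refl ; (suc _) → ~-refl }))
        (funs k ys))

  upd-symmetry : ∀ {k} (i : Fin k) ys {φ} → Congruent φ → IsSymmetry _~_ ys φ →
    IsSymmetry _≋_ (funs k ys) (upd i φ)
  upd-symmetry {suc k} zero ys {φ} φ-cong φ-sym w w-inv = begin
    sum (map w (funs (suc k) ys))
      ≡⟨ sum-funs-suc ys w w-inv ⟩
    sum (map (headSum ys w) ys)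
      ≡⟨ φ-sym (headSum ys w) headSum-inv ⟩
    sum (map (headSum ys w ∘ φ) ys)
      ≡⟨ sum-map-cong (λ a → sum-map-cong (λ f → w-inv _ _ (update-head a f))
           (funs k ys)) ys ⟩
    sum (map (headSum ys (w ∘ upd zero φ)) ys)
      ≡⟨ sum-funs-suc ys (w ∘ upd zero φ)
           (λ f g → w-inv _ _ ∘ upd-≋ zero φ-cong) ⟨
    sum (map (w ∘ upd zero φ) (funs (suc k) ys)) ∎
    where
    headSum-inv : Invariant _~_ (headSum ys w)
    headSum-inv a b a~b =
      sum-map-cong (λ f → w-inv _ _ (cons-≋ a~b (λ _ → ~-refl))) (funs k ys)
    update-head : ∀ a f → cons (φ a) f ≋ upd zero φ (cons a f)
    update-head a f zero    = ~-refl
    update-head a f (suc _) = ~-refl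
  upd-symmetry {suc k} (suc j) ys {φ} φ-cong φ-sym w w-inv = begin
    sum (map w (funs (suc k) ys))
      ≡⟨ sum-funs-suc ys w w-inv ⟩
    sum (map (headSum ys w) ys)
      ≡⟨ sum-map-cong (λ a → upd-symmetry j ys φ-cong φ-sym (w ∘ cons a)
           (λ f g f≋g → w-inv _ _ (cons-≋ ~-refl f≋g))) ys ⟩
    sum (map (λ a → sum (map (w ∘ cons a ∘ upd j φ) (funs k ys))) ys)
      ≡⟨ sum-map-cong (λ a → sum-map-cong (λ f → w-inv _ _ (update-tail a f))
           (funs k ys)) ys ⟩
    sum (map (headSum ys (w ∘ upd (suc j) φ)) ys)
      ≡⟨ sum-funs-suc ys (w ∘ upd (suc j) φ)
           (λ f g → w-inv _ _ ∘ upd-≋ (suc j) φ-cong) ⟨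
    sum (map (w ∘ upd (suc j) φ) (funs (suc k) ys)) ∎
    where
    update-tail : ∀ a f → cons a (upd j φ f) ≋ upd (suc j) φ (cons a f)
    update-tail a f zero    = ~-refl
    update-tail a f (suc _) = ~-refl


module _ {k : ℕ} where

  ∧-eqˡ : ∀ {x y : Fin k} → x ≤ᶠ y → x ∧ y ≡ x
  ∧-eqˡ {x} {y} x≤y with x ≤? y
  ... | yes _   = refl
  ... | no  x≰y = ⊥-elim (x≰y x≤y)

  ∧-eqʳ : ∀ {x y : Fin k} → y ≤ᶠ x → x ∧ y ≡ y
  ∧-eqʳ {x} {y} y≤x with x ≤? y
  ... | yes x≤y = ≤-antisym x≤y y≤x
  ... | no  _   = refl

  ∧-lowerˡ : ∀ (x y : Fin k) → x ∧ y ≤ᶠ x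
  ∧-lowerˡ x y with x ≤? y
  ... | yes _   = ≤-refl
  ... | no  x≰y = ≰⇒≥ x≰y

  ∧-lowerʳ : ∀ (x y : Fin k) → x ∧ y ≤ᶠ y
  ∧-lowerʳ x y with x ≤? y
  ... | yes x≤y = x≤y
  ... | no  _   = ≤-refl

module _ {m : ℕ} where

  ∧-top : ∀ (x : Fin (suc m)) → x ∧ top m ≡ x
  ∧-top x = ∧-eqˡ (≤fromℕ x)

  top-∧ : ∀ (x : Fin (suc m)) → top m ∧ x ≡ x
  top-∧ x = ∧-eqʳ (≤fromℕ x)

  ∧≡top : ∀ (x y : Fin (suc m)) → x ∧ y ≡ top m → x ≡ top m × y ≡ top m
  ∧≡top x y x∧y≡top =
    ≤-antisym (≤fromℕ x) (subst (_≤ᶠ x) x∧y≡top (∧-lowerˡ x y)) ,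
    ≤-antisym (≤fromℕ y) (subst (_≤ᶠ y) x∧y≡top (∧-lowerʳ x y))


penult : ∀ p → Fin (suc (suc p))
penult zero    = zero
penult (suc p) = suc (penult p)

penult≤top : ∀ p → penult p ≤ᶠ top (suc p)
penult≤top zero    = z≤n
penult≤top (suc p) = s≤s (penult≤top p)

penult≢top : ∀ p → ¬ penult p ≡ top (suc p)
penult≢top zero    ()
penult≢top (suc p) e = penult≢top p (suc-injective e)

below-penult-or-top : ∀ p (x : Fin (suc (suc p))) → x ≤ᶠ penult p ⊎ x ≡ top (suc p)
below-penult-or-top zero    zero          = inj₁ z≤n
below-penult-or-top zero    (suc zero)    = inj₂ refl
below-penult-or-top (suc p) zero          = inj₁ z≤n
below-penult-or-top (suc p) (suc x) with below-penult-or-top p x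
... | inj₁ x≤penult = inj₁ (s≤s x≤penult)
... | inj₂ x≡top    = inj₂ (cong suc x≡top)

above-penult : ∀ p {y} → penult p ≤ᶠ y → y ≡ penult p ⊎ y ≡ top (suc p)
above-penult p {y} penult≤y with below-penult-or-top p y
... | inj₁ y≤penult = inj₁ (≤-antisym y≤penult penult≤y)
... | inj₂ y≡top    = inj₂ y≡top

swapTop : ∀ p → Fin (suc (suc p)) → Fin (suc (suc p))
swapTop zero    zero       = suc zero
swapTop zero    (suc zero) = zero
swapTop (suc p) zero       = zero
swapTop (suc p) (suc x)    = suc (swapTop p x)

swapTop-penult : ∀ p → swapTop p (penult p) ≡ top (suc p)
swapTop-penult zero    = refl
swapTop-penult (suc p) = cong suc (swapTop-penult p)

swapTop-top : ∀ p → swapTop p (top (suc p)) ≡ penult p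
swapTop-top zero    = refl
swapTop-top (suc p) = cong suc (swapTop-top p)

swapTop-involutive : ∀ p x → swapTop p (swapTop p x) ≡ x
swapTop-involutive zero    zero       = refl
swapTop-involutive zero    (suc zero) = refl
swapTop-involutive (suc p) zero       = refl
swapTop-involutive (suc p) (suc x)    = cong suc (swapTop-involutive p x)

swapTop≡penult : ∀ p {y} → swapTop p y ≡ penult p → y ≡ top (suc p)
swapTop≡penult p {y} swap-y≡penult = begin
  y                      ≡⟨ swapTop-involutive p y ⟨
  swapTop p (swapTop p y) ≡⟨ cong (swapTop p) swap-y≡penult ⟩
  swapTop p (penult p)    ≡⟨ swapTop-penult p ⟩
  top (suc p)             ∎

swapTop-above : ∀ p {y} → penult p ≤ᶠ y → penult p ≤ᶠ swapTop p y
swapTop-above p penult≤y with above-penult p penult≤y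
... | inj₁ refl = subst (penult p ≤ᶠ_) (sym (swapTop-penult p)) (penult≤top p)
... | inj₂ refl = subst (penult p ≤ᶠ_) (sym (swapTop-top p)) ≤-refl

sum-allFin-suc : ∀ k (h : Fin (suc k) → ℕ) →
  sum (map h (allFinL (suc k))) ≡ h zero + sum (map (h ∘ suc) (allFinL k))
sum-allFin-suc k h = cong (λ l → h zero + sum l) (sym (map-∘ (allFinL k)))

swapTop-symmetry : ∀ p → IsSymmetry _≡_ (allFinL (suc (suc p))) (swapTop p)
swapTop-symmetry zero h _ = begin
  h zero + (h (suc zero) + 0) ≡⟨ x∙yz≈y∙xz (h zero) (h (suc zero)) 0 ⟩
  h (suc zero) + (h zero + 0) ∎
swapTop-symmetry (suc p) h _ = begin
  sum (map h (allFinL (suc (suc (suc p)))))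
    ≡⟨ sum-allFin-suc (suc (suc p)) h ⟩
  h zero + sum (map (h ∘ suc) (allFinL (suc (suc p))))
    ≡⟨ cong (h zero +_) (swapTop-symmetry p (h ∘ suc) (λ _ _ → cong (h ∘ suc))) ⟩
  h zero + sum (map (h ∘ suc ∘ swapTop p) (allFinL (suc (suc p))))
    ≡⟨ sum-allFin-suc (suc (suc p)) (h ∘ swapTop (suc p)) ⟨
  sum (map (h ∘ swapTop (suc p)) (allFinL (suc (suc (suc p))))) ∎


module SemiHeytingChain (p : ℕ) where

  n m : ℕ
  n = suc (suc p)
  m = suc p

  r c : Fin n
  r = penult p
  c = top m

  IsSH : Op n → Set
  IsSH = IsSemiHeyting m

  sh-above-penult : ∀ {f} → IsSH f → r ≤ᶠ f r c
  sh-above-penult {f} (sh2 , _) =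
    subst (_≤ᶠ f r c) (trans (sh2 r c) (∧-eqˡ (penult≤top p))) (∧-lowerʳ r (f r c))

  AgreeOffRC : Op n → Op n → Set
  AgreeOffRC f g = ∀ x y → ¬ (x ≡ r × y ≡ c) → g x y ≡ f x y

  retarget : ∀ {f g} → IsSH f → AgreeOffRC f g → r ≤ᶠ g r c → IsSH g
  retarget {f} {g} (sh2 , sh3 , sh4) agree r≤grc = sh2′ , sh3′ , sh4′
    where
    sh4′ : ∀ x → g x x ≡ top m
    sh4′ x = trans (agree x x (λ (x≡r , x≡c) → penult≢top p (trans (sym x≡r) x≡c)))
                   (sh4 x)

    below : ∀ {x} → x ≤ᶠ r → x ∧ g r c ≡ x
    below x≤r = ∧-eqˡ (≤-trans x≤r r≤grc)

    sh2′ : ∀ x y → x ∧ g x y ≡ x ∧ y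
    sh2′ x y with (x ≟ r) ×-dec (y ≟ c)
    ... | yes (refl , refl) = trans (below ≤-refl) (sym (∧-eqˡ (penult≤top p)))
    ... | no  xy≢rc         = trans (cong (x ∧_) (agree x y xy≢rc)) (sh2 x y)

    sh3′ : ∀ x y z → x ∧ g y z ≡ x ∧ g (x ∧ y) (x ∧ z)
    sh3′ x y z with (y ≟ r) ×-dec (z ≟ c)
    sh3′ x y z | yes (refl , refl) with below-penult-or-top p x
    ... | inj₁ x≤r = begin
      x ∧ g r c               ≡⟨ below x≤r ⟩
      x                       ≡⟨ ∧-top x ⟨
      x ∧ top m               ≡⟨ cong (x ∧_) (sh4′ x) ⟨
      x ∧ g x x               ≡⟨ cong₂ (λ u v → x ∧ g u v)
                                   (∧-eqˡ x≤r) (∧-eqˡ (≤-trans x≤r (penult≤top p))) ⟨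
      x ∧ g (x ∧ r) (x ∧ c)   ∎
    ... | inj₂ refl =
      cong₂ (λ u v → c ∧ g u v) (sym (top-∧ r)) (sym (top-∧ c))
    sh3′ x y z | no yz≢rc = begin
      x ∧ g y z               ≡⟨ cong (x ∧_) (agree y z yz≢rc) ⟩
      x ∧ f y z               ≡⟨ sh3 x y z ⟩
      x ∧ f (x ∧ y) (x ∧ z)   ≡⟨ cong (x ∧_) (agree _ _ meets≢rc) ⟨
      x ∧ g (x ∧ y) (x ∧ z)   ∎
      where
      -- x ∧ z = c forces x = z = c, and then x ∧ y = y.
      meets≢rc : ¬ (x ∧ y ≡ r × x ∧ z ≡ c)
      meets≢rc (xy≡r , xz≡c) = yz≢rc (y≡r , proj₂ (∧≡top x z xz≡c))
        where
        y≡r : y ≡ r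
        y≡r = begin
          y      ≡⟨ top-∧ y ⟨
          c ∧ y  ≡⟨ cong (_∧ y) (proj₁ (∧≡top x z xz≡c)) ⟨
          x ∧ y  ≡⟨ xy≡r ⟩
          r      ∎

  IsSH-resp : ∀ {f g} → (∀ x y → f x y ≡ g x y) → IsSH f → IsSH g
  IsSH-resp {f} f≗g sh =
    retarget sh (λ x y _ → sym (f≗g x y)) (subst (r ≤ᶠ_) (f≗g r c) (sh-above-penult sh))

  swap : Fin n → Fin n
  swap = swapTop p

  σ : Op n → Op n
  σ = upd r (upd c swap)

  σ-at-rc : ∀ f → σ f r c ≡ swap (f r c)
  σ-at-rc f = trans (cong (λ row → row c) (upd-here r (upd c swap) f))
                    (upd-here c swap (f r))

  σ-agree : ∀ f → AgreeOffRC f (σ f)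
  σ-agree f x y xy≢rc with x ≟ r
  ... | yes refl = trans (cong (λ row → row y) (upd-here r (upd c swap) f))
                         (upd-elsewhere c y swap (f r) (λ y≡c → xy≢rc (refl , y≡c)))
  ... | no  x≢r  = cong (λ row → row y) (upd-elsewhere r x (upd c swap) f x≢r)

  σ-preserves : ∀ {f} → IsSH f → IsSH (σ f)
  σ-preserves {f} sh = retarget sh (σ-agree f)
    (subst (r ≤ᶠ_) (sym (σ-at-rc f)) (swapTop-above p (sh-above-penult sh)))

  σ-reflects : ∀ {f} → IsSH (σ f) → IsSH f
  σ-reflects {f} sh = retarget sh (λ x y xy≢rc → sym (σ-agree f x y xy≢rc))
    (subst (r ≤ᶠ_) (trans (cong swap (σ-at-rc f)) (swapTop-involutive p (f r c)))
      (swapTop-above p (sh-above-penult sh)))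


  module Values = Reindexing {Fin n} _≡_ refl
  module Rows   = Reindexing {Fin n → Fin n} Values._≋_ (λ _ → refl)

  σ-symmetry : IsSymmetry Rows._≋_ (allOps n) σ
  σ-symmetry = Rows.upd-symmetry r (funs n (allFinL n)) (λ _ _ → Values.upd-≋ c (λ _ _ → cong swap))
    (Values.upd-symmetry c (allFinL n) (λ _ _ → cong swap) (swapTop-symmetry p))

  shAt : Fin n → Op n → ℕ
  shAt v f = 𝟙 (isSemiHeyting? m f ×-dec (f r c ≟ v))

  shAt-invariant : ∀ v → Invariant Rows._≋_ (shAt v)
  shAt-invariant v f g f≋g =
    𝟙-cong (isSemiHeyting? m f ×-dec (f r c ≟ v)) (isSemiHeyting? m g ×-dec (g r c ≟ v))
    (λ (sh , frc≡v) → IsSH-resp f≋g sh , trans (sym (f≋g r c)) frc≡v)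
    (λ (sh , grc≡v) → IsSH-resp (λ x y → sym (f≋g x y)) sh , trans (f≋g r c) grc≡v)

  shAt-split : ∀ f → 𝟙 (isSemiHeyting? m f) ≡ shAt r f + shAt c f
  shAt-split f = 𝟙-split (isSemiHeyting? m f) (f r c ≟ r) (f r c ≟ c)
    (above-penult p ∘ sh-above-penult)
    (λ (frc≡r , frc≡c) → penult≢top p (trans (sym frc≡r) frc≡c))

  shAt-σ : ∀ f → shAt r (σ f) ≡ shAt c f
  shAt-σ f =
    𝟙-cong (isSemiHeyting? m (σ f) ×-dec (σ f r c ≟ r)) (isSemiHeyting? m f ×-dec (f r c ≟ c))
    (λ (sh , σfrc≡r) → σ-reflects sh ,
      swapTop≡penult p (trans (sym (σ-at-rc f)) σfrc≡r))
    (λ (sh , frc≡c) → σ-preserves sh ,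
      trans (σ-at-rc f) (trans (cong swap frc≡c) (swapTop-top p)))

  total : (Op n → ℕ) → ℕ
  total w = sum (map w (allOps n))

  N-twice : N n ≡ total (shAt c) * 2
  N-twice = begin
    N n                                 ≡⟨ length-filter (isSemiHeyting? m) (allOps n) ⟩
    total (𝟙 ∘ isSemiHeyting? m)        ≡⟨ sum-map-cong shAt-split (allOps n) ⟩
    total (λ f → shAt r f + shAt c f)   ≡⟨ sum-map-+ (shAt r) (shAt c) (allOps n) ⟩
    total (shAt r) + total (shAt c)     ≡⟨ cong (_+ total (shAt c))
                                             (σ-symmetry (shAt r) (shAt-invariant r)) ⟩
    total (shAt r ∘ σ) + total (shAt c) ≡⟨ cong (_+ total (shAt c))
                                             (sum-map-cong shAt-σ (allOps n)) ⟩
    total (shAt c) + total (shAt c)     ≡⟨ cong (total (shAt c) +_)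
                                             (+-identityʳ (total (shAt c))) ⟨
    2 * total (shAt c)                  ≡⟨ *-comm 2 (total (shAt c)) ⟩
    total (shAt c) * 2                  ∎

  N-even : 2 ∣ N n
  N-even = divides (total (shAt c)) N-twice


mainTheorem3 : ∀ (n : ℕ) → 2 ≤ n → 2 ∣ N n
mainTheorem3 zero          ()
mainTheorem3 (suc zero)    (s≤s ())
mainTheorem3 (suc (suc p)) _ = SemiHeytingChain.N-even p
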